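{- Let $n$ be a non-negative integer such that the Fermat number $2^{2^n}+1$ is not prime. Let $a$ be a positive integer with $a<2^n$. Then there are exactly $2^t$ positive integers $m$ such that $\varphi(m)=2^{2^n+a}$, where $t$ is the number of prime Fermat numbers that are less than $2^{2^n}+1$.
   Context: $\varphi$ denotes Euler's totient function. A Fermat number is a number of the form $2^{2^j}+1$ with $j$ a non-negative integer; a prime Fermat number is a Fermat number that is prime. -}

module Defs where

open import Data.Nat using (ℕ; zero; suc; _+_; _^_; _<_; _<?_)
open import Data.Nat.GCD using (gcd)
open import Data.Nat.Primality using (Prime; prime?)
open import Data.List using (List; length; filter; upTo; map)
open import Data.Product using (_×_)
open import Relation.Nullary.Decidable using (_×-dec_)
import Data.Nat as N

-- Euler's totient: φ m = #{ k ∈ {1,…,m} : gcd k m = 1 }  (so φ 0 = 0, φ 1 = 1)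
φ : ℕ → ℕ
φ m = length (filter (λ k → gcd k m N.≟ 1) (map suc (upTo m)))

fermat : ℕ → ℕ
fermat j = 2 ^ (2 ^ j) + 1

-- Number of prime Fermat numbers less than x. Every Fermat number fermat j < x
-- has j < x, and j ↦ fermat j is injective, so counting indices j < x counts
-- the Fermat numbers themselves.
primeFermatsBelow : ℕ → ℕ
primeFermatsBelow x =
  length (filter (λ j → (fermat j <? x) ×-dec prime? (fermat j)) (upTo x))

module Submission where

-- Let N = 2^n + a with 0 < a < 2^n, and let F_j = 2^(2^j) + 1 with F_n composite.
-- The proof follows the classical description of the solutions of φ(m) = 2^N.
--
--  * φ is written as a finite sum of coprimality indicators; this gives the two
--    recurrences φ(p·m) = p·φ(m) for p ∣ m and φ(p·m) = (p − 1)·φ(m) for a prime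
--    p ∤ m, hence φ(2^e) = 2^(e−1).
--  * If φ(m) = 2^K, every odd prime p ∣ m divides m exactly once and p − 1 is a
--    power of two, so p is a Fermat prime F_j with 2^j ≤ K (2^i + 1 prime forces i
--    to be a power of two).
--  * Peeling these Fermat primes off one at a time, every such m is 2^e·o where o is
--    a product of distinct Fermat primes F_j (j < k) and K = (e − 1) + Σ 2^j; the
--    relation 'FermatProduct k o s' describes such o together with its weight
--    s = Σ 2^j.
--  * For K = N all indices satisfy 2^j ≤ N < 2^(n+1), so j ≤ n, and j ≠ n since F_n
--    is composite.  The weight is then s < 2^n ≤ N, so each FermatProduct n o s gives
--    exactly one solution 2^(N−s+1)·o.  These are enumerated by an explicit
--    duplicate-free list of length 2^t, t = #{j < n : F_j prime}.

open import Defs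
open import Data.Nat using (ℕ; zero; suc; _+_; _*_; _∸_; _^_; _<_; _≤_; z≤n; s≤s; NonZero; >-nonZero; nonTrivial⇒≢1; _≟_; _<?_)
open import Data.Nat.Properties
open import Data.Nat.Tactic.RingSolver using (solve-∀)
open import Data.Nat.Divisibility
open import Data.Nat.GCD using (gcd)
open import Data.Nat.Coprimality as Coprimality using (Coprime; coprime?; gcd≡1⇒coprime; coprime⇒gcd≡1; coprime-divisor; coprime-+)
open import Data.Nat.Primality
open import Data.Nat.Primality.Factorisation using (factorise; PrimeFactorisation)
open import Data.Nat.ListAction using (product)
open import Data.Nat.ListAction.Properties using (∈⇒∣product)
open import Data.List using (List; []; _∷_; _++_; length; filter; map; applyUpTo)
open import Data.List.Properties using (map-upTo; length-map; length-++)
open import Data.List.Membership.Propositional using (_∈_)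
open import Data.List.Membership.Propositional.Properties using (∈-map⁺; ∈-map⁻; ∈-++⁺ˡ; ∈-++⁺ʳ; ∈-++⁻)
open import Data.List.Relation.Unary.Any using (here; there)
open import Data.List.Relation.Unary.All as All using (All; []; _∷_)
open import Data.List.Relation.Unary.All.Properties using (map⁺)
open import Data.List.Relation.Unary.AllPairs using ([]; _∷_)
open import Data.List.Relation.Unary.Unique.Propositional using (Unique)
import Data.List.Relation.Unary.Unique.Propositional.Properties as Unique
open import Data.List.Relation.Binary.Disjoint.Propositional using (Disjoint)
open import Data.Product using (Σ; _×_; _,_; proj₁; proj₂; ∃; uncurry)
open import Data.Sum using (_⊎_; inj₁; inj₂)
open import Relation.Nullary using (¬_; Dec; yes; no; contradiction)
open import Relation.Nullary.Decidable using (_×-dec_)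
open import Relation.Unary using (Decidable)
open import Relation.Binary using (tri<; tri≈; tri>)
open import Relation.Binary.PropositionalEquality
open import Function.Bundles using (_⇔_; mk⇔)

-- Finite sums and indicators

∑ : ℕ → (ℕ → ℕ) → ℕ
∑ zero    f = 0
∑ (suc n) f = ∑ n f + f n

syntax ∑ n (λ k → e) = ∑[ k < n ] e

𝟙 : ∀ {A : Set} → Dec A → ℕ
𝟙 (yes _) = 1
𝟙 (no _)  = 0

𝟙-yes : ∀ {A : Set} (d : Dec A) → A → 𝟙 d ≡ 1
𝟙-yes (yes _) _ = refl
𝟙-yes (no ¬a) a = contradiction a ¬a

𝟙-no : ∀ {A : Set} (d : Dec A) → ¬ A → 𝟙 d ≡ 0
𝟙-no (yes a) ¬a = contradiction a ¬a
𝟙-no (no _)  _  = refl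

𝟙-cong : ∀ {A B : Set} → (A → B) → (B → A) → (a : Dec A) (b : Dec B) → 𝟙 a ≡ 𝟙 b
𝟙-cong f g (yes a) b = sym (𝟙-yes b (f a))
𝟙-cong f g (no ¬a) b = sym (𝟙-no b (λ x → ¬a (g x)))

∑-cong : ∀ {f g : ℕ → ℕ} n → (∀ k → k < n → f k ≡ g k) → ∑ n f ≡ ∑ n g
∑-cong zero    f≡g = refl
∑-cong (suc n) f≡g = cong₂ _+_ (∑-cong n (λ k k<n → f≡g k (m<n⇒m<1+n k<n))) (f≡g n ≤-refl)

∑-zero : ∀ {f : ℕ → ℕ} n → (∀ k → k < n → f k ≡ 0) → ∑ n f ≡ 0
∑-zero zero    f≡0 = refl
∑-zero (suc n) f≡0 = cong₂ _+_ (∑-zero n (λ k k<n → f≡0 k (m<n⇒m<1+n k<n))) (f≡0 n ≤-refl)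

∑-front : ∀ (f : ℕ → ℕ) n → ∑ (suc n) f ≡ f 0 + ∑[ k < n ] f (suc k)
∑-front f zero    = +-comm 0 (f 0)
∑-front f (suc n) = trans (cong (_+ f (suc n)) (∑-front f n)) (+-assoc (f 0) _ _)

∑-split : ∀ (f : ℕ → ℕ) a b → ∑ (a + b) f ≡ ∑ a f + ∑[ k < b ] f (a + k)
∑-split f a zero    rewrite +-identityʳ a = sym (+-identityʳ _)
∑-split f a (suc b) rewrite +-suc a b =
  trans (cong (_+ f (a + b)) (∑-split f a b)) (+-assoc (∑ a f) _ _)

∑-distrib : ∀ (f g : ℕ → ℕ) n → ∑[ k < n ] (f k + g k) ≡ ∑ n f + ∑ n g
∑-distrib f g zero    = refl
∑-distrib f g (suc n) rewrite ∑-distrib f g n = interchange (∑ n f) (∑ n g) (f n) (g n)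
  where
  interchange : ∀ a b c d → a + b + (c + d) ≡ a + c + (b + d)
  interchange = solve-∀

∑-periodic : ∀ (f : ℕ → ℕ) m q → (∀ k → f (m + k) ≡ f k) → ∑ (q * m) f ≡ q * ∑ m f
∑-periodic f m zero    per = refl
∑-periodic f m (suc q) per =
  trans (∑-split f m (q * m)) (cong (∑ m f +_) (trans (∑-cong (q * m) (λ k _ → per k)) (∑-periodic f m q per)))

∑-rotate : ∀ (f : ℕ → ℕ) n → f n ≡ f 0 → ∑[ k < n ] f (suc k) ≡ ∑ n f
∑-rotate f n fn≡f0 = +-cancelʳ-≡ (f 0) _ _ (begin
  ∑[ k < n ] f (suc k) + f 0 ≡⟨ +-comm _ (f 0) ⟩
  f 0 + ∑[ k < n ] f (suc k) ≡⟨ sym (∑-front f n) ⟩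
  ∑ n f + f n                ≡⟨ cong (∑ n f +_) fn≡f0 ⟩
  ∑ n f + f 0                ∎)
  where open ≡-Reasoning

-- Summing h over the multiples of p below p · n: in each block [p·j, p·j + p)
-- only p·j is divisible by p.
∑-multiples : ∀ p .{{_ : NonZero p}} (h : ℕ → ℕ) n →
  ∑[ k < p * n ] (𝟙 (p ∣? k) * h k) ≡ ∑[ j < n ] h (p * j)
∑-multiples p h zero rewrite *-zeroʳ p = refl
∑-multiples p@(suc q) h (suc n) = begin
  ∑ (p * suc n) f                           ≡⟨ cong (λ t → ∑ t f) (trans (*-suc p n) (+-comm p (p * n))) ⟩
  ∑ (p * n + p) f                           ≡⟨ ∑-split f (p * n) p ⟩
  ∑ (p * n) f + ∑[ i < p ] f (p * n + i)    ≡⟨ cong₂ _+_ (∑-multiples p h n) block ⟩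
  ∑[ j < n ] h (p * j) + h (p * n)          ∎
  where
  open ≡-Reasoning
  f : ℕ → ℕ
  f k = 𝟙 (p ∣? k) * h k
  first : f (p * n + 0) ≡ h (p * n)
  first rewrite +-identityʳ (p * n) | 𝟙-yes (p ∣? (p * n)) (m∣m*n n) = +-identityʳ _
  rest : ∀ i → i < q → f (p * n + suc i) ≡ 0
  rest i i<q rewrite 𝟙-no (p ∣? (p * n + suc i)) (λ p∣ → <⇒≱ (s≤s i<q) (∣⇒≤ (∣m+n∣m⇒∣n p∣ (m∣m*n n)))) = refl
  block : ∑[ i < p ] f (p * n + i) ≡ h (p * n)
  block = begin
    ∑[ i < p ] f (p * n + i)                           ≡⟨ ∑-front (λ i → f (p * n + i)) q ⟩
    f (p * n + 0) + ∑[ i < q ] f (p * n + suc i)       ≡⟨ cong₂ _+_ first (∑-zero q rest) ⟩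
    h (p * n) + 0                                      ≡⟨ +-identityʳ _ ⟩
    h (p * n)                                          ∎

length-filter : ∀ {P : ℕ → Set} (P? : Decidable P) f n →
  length (filter P? (applyUpTo f n)) ≡ ∑[ k < n ] 𝟙 (P? (f k))
length-filter P? f zero    = refl
length-filter P? f (suc n) rewrite ∑-front (λ k → 𝟙 (P? (f k))) n with P? (f 0)
... | yes _ = cong suc (length-filter P? (λ k → f (suc k)) n)
... | no _  = length-filter P? (λ k → f (suc k)) n

-- Coprimality

coprime-∣ʳ : ∀ {k m d} → Coprime k m → d ∣ m → Coprime k d
coprime-∣ʳ k⊥m d∣m (i∣k , i∣d) = k⊥m (i∣k , ∣-trans i∣d d∣m)

coprime-∣ˡ : ∀ {k m d} → Coprime k m → d ∣ k → Coprime d m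
coprime-∣ˡ k⊥m d∣k (i∣d , i∣m) = k⊥m (∣-trans i∣d d∣k , i∣m)

coprime-*ʳ : ∀ {k a b} → Coprime k a → Coprime k b → Coprime k (a * b)
coprime-*ʳ k⊥a k⊥b (i∣k , i∣ab) = k⊥b (i∣k , coprime-divisor (coprime-∣ˡ k⊥a i∣k) i∣ab)

coprime-+⁻ : ∀ {m k} → Coprime (m + k) m → Coprime k m
coprime-+⁻ c (i∣k , i∣m) = c (∣m∣n⇒∣m+n i∣m i∣k , i∣m)

prime≢1 : ∀ {p} → Prime p → p ≢ 1
prime≢1 pr = nonTrivial⇒≢1 {{prime⇒nonTrivial pr}}

prime-∤⇒coprime : ∀ {p k} → Prime p → ¬ p ∣ k → Coprime p k
prime-∤⇒coprime pr p∤k (i∣p , i∣k) with prime⇒irreducible pr i∣p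
... | inj₁ i≡1 = i≡1
... | inj₂ refl = contradiction i∣k p∤k

-- Euler's totient as a sum of coprimality indicators

coprimeTo : ℕ → ℕ → ℕ
coprimeTo m k = 𝟙 (coprime? k m)

coprimeTo-cong : ∀ {m m′ a b} → (Coprime a m → Coprime b m′) → (Coprime b m′ → Coprime a m) →
  coprimeTo m a ≡ coprimeTo m′ b
coprimeTo-cong f g = 𝟙-cong f g _ _

coprimeTo-periodic : ∀ m k → coprimeTo m (m + k) ≡ coprimeTo m k
coprimeTo-periodic m k = coprimeTo-cong coprime-+⁻ coprime-+

-- φ m = #{ k < m : k coprime to m }.  The definition counts 1 ≤ k ≤ m instead,
-- which is the same since 0 and m have the same common divisors with m.
φ-sum : ∀ m → φ m ≡ ∑ m (coprimeTo m)
φ-sum m = begin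
  φ m                                                   ≡⟨ cong (λ l → length (filter (λ k → gcd k m ≟ 1) l)) (map-upTo suc m) ⟩
  length (filter (λ k → gcd k m ≟ 1) (applyUpTo suc m)) ≡⟨ length-filter (λ k → gcd k m ≟ 1) suc m ⟩
  ∑[ k < m ] 𝟙 (gcd (suc k) m ≟ 1)                      ≡⟨ ∑-cong m (λ k _ → 𝟙-cong gcd≡1⇒coprime coprime⇒gcd≡1 _ _) ⟩
  ∑[ k < m ] coprimeTo m (suc k)                        ≡⟨ ∑-rotate (coprimeTo m) m m≡0 ⟩
  ∑ m (coprimeTo m)                                     ∎
  where
  open ≡-Reasoning
  m≡0 : coprimeTo m m ≡ coprimeTo m 0
  m≡0 = coprimeTo-cong (λ c (_ , d∣m) → c (d∣m , d∣m)) (λ c (d∣m , _) → c (_ ∣0 , d∣m))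

-- Multiplying by a divisor p of m: k is coprime to p · m iff it is coprime to m.
φ-*-divisor : ∀ p m → p ∣ m → φ (p * m) ≡ p * φ m
φ-*-divisor p m p∣m = begin
  φ (p * m)                     ≡⟨ φ-sum (p * m) ⟩
  ∑ (p * m) (coprimeTo (p * m)) ≡⟨ ∑-cong (p * m) (λ k _ → coprimeTo-cong (λ c → coprime-∣ʳ c (n∣m*n p))
                                                                           (λ c → coprime-*ʳ (coprime-∣ʳ c p∣m) c)) ⟩
  ∑ (p * m) (coprimeTo m)       ≡⟨ ∑-periodic (coprimeTo m) m p (coprimeTo-periodic m) ⟩
  p * ∑ m (coprimeTo m)         ≡⟨ cong (p *_) (sym (φ-sum m)) ⟩
  p * φ m                       ∎
  where open ≡-Reasoning

-- Multiplying by a prime p ∤ m.  Below p · m, the numbers coprime to m are those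
-- coprime to p · m together with the multiples p · j of p with j coprime to m.
φ-*-prime : ∀ p m → Prime p → ¬ p ∣ m → φ (p * m) ≡ (p ∸ 1) * φ m
φ-*-prime p m pr p∤m = +-cancelʳ-≡ (φ m) _ _ (begin
  φ (p * m) + φ m                                     ≡⟨ cong₂ _+_ (φ-sum (p * m)) (φ-sum m) ⟩
  ∑ (p * m) (coprimeTo (p * m)) + ∑ m (coprimeTo m)   ≡⟨ cong (∑ (p * m) (coprimeTo (p * m)) +_) multiples ⟩
  ∑ (p * m) (coprimeTo (p * m)) + ∑ (p * m) f         ≡⟨ sym (∑-distrib (coprimeTo (p * m)) f (p * m)) ⟩
  ∑[ k < p * m ] (coprimeTo (p * m) k + f k)          ≡⟨ sym (∑-cong (p * m) (λ k _ → split k)) ⟩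
  ∑ (p * m) (coprimeTo m)                             ≡⟨ ∑-periodic (coprimeTo m) m p (coprimeTo-periodic m) ⟩
  p * ∑ m (coprimeTo m)                               ≡⟨ cong (p *_) (sym (φ-sum m)) ⟩
  p * φ m                                             ≡⟨ pred-split p (φ m) ⟩
  (p ∸ 1) * φ m + φ m                                 ∎)
  where
  open ≡-Reasoning
  instance
    p≢0 : NonZero p
    p≢0 = prime⇒nonZero pr
  m⊥p : Coprime m p
  m⊥p = Coprimality.sym (prime-∤⇒coprime pr p∤m)
  f : ℕ → ℕ
  f k = 𝟙 (p ∣? k) * coprimeTo m k
  multiples : ∑ m (coprimeTo m) ≡ ∑ (p * m) f
  multiples = sym (trans (∑-multiples p (coprimeTo m) m)
    (∑-cong m (λ j _ → coprimeTo-cong (λ c → coprime-∣ˡ c (n∣m*n p))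
                                      (λ c → Coprimality.sym (coprime-*ʳ m⊥p (Coprimality.sym c))))))
  split : ∀ k → coprimeTo m k ≡ coprimeTo (p * m) k + f k
  split k with p ∣? k
  ... | yes p∣k rewrite 𝟙-no (coprime? k (p * m)) (λ c → prime≢1 pr (c (p∣k , m∣m*n m))) = sym (+-identityʳ _)
  ... | no p∤k = trans (coprimeTo-cong (coprime-*ʳ (Coprimality.sym (prime-∤⇒coprime pr p∤k)))
                                       (λ c → coprime-∣ʳ c (n∣m*n p)))
                       (sym (+-identityʳ _))
  pred-split : ∀ q .{{_ : NonZero q}} x → q * x ≡ (q ∸ 1) * x + x
  pred-split (suc q) x = +-comm x (q * x)

φ-2^ : ∀ e → φ (2 ^ e) ≡ 2 ^ (e ∸ 1)
φ-2^ zero          = refl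
φ-2^ (suc zero)    = refl
φ-2^ (suc (suc e)) = trans (φ-*-divisor 2 (2 ^ suc e) (m∣m*n (2 ^ e))) (cong (2 *_) (φ-2^ (suc e)))

-- Powers of two

prime∣2^⇒≡2 : ∀ K {p} → Prime p → p ∣ 2 ^ K → p ≡ 2
prime∣2^⇒≡2 zero    pr p∣1 = contradiction (∣1⇒≡1 p∣1) (prime≢1 pr)
prime∣2^⇒≡2 (suc K) pr p∣2^K+1 with euclidsLemma 2 (2 ^ K) pr p∣2^K+1
... | inj₂ p∣2^K = prime∣2^⇒≡2 K pr p∣2^K
... | inj₁ p∣2 with prime⇒irreducible prime[2] p∣2
...   | inj₁ p≡1 = contradiction p≡1 (prime≢1 pr)
...   | inj₂ p≡2 = p≡2

only-2⇒2^ : ∀ m → 0 < m → (∀ {p} → Prime p → p ∣ m → p ≡ 2) → ∃ λ e → m ≡ 2 ^ e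
only-2⇒2^ (suc m) _ only-2 = length factors , trans isFactorisation (product-2s factors all-2)
  where
  open PrimeFactorisation (factorise (suc m))
  all-2 : All (_≡ 2) factors
  all-2 = All.tabulate (λ {p} p∈ → only-2 (All.lookup factorsPrime p∈)
                                          (subst (p ∣_) (sym isFactorisation) (∈⇒∣product p∈)))
  product-2s : ∀ ps → All (_≡ 2) ps → product ps ≡ 2 ^ length ps
  product-2s []       []           = refl
  product-2s (_ ∷ ps) (refl ∷ all) = cong (2 *_) (product-2s ps all)

∣2^⇒2^ : ∀ K d → d ∣ 2 ^ K → ∃ λ e → d ≡ 2 ^ e
∣2^⇒2^ K zero    0∣2^K = contradiction (0∣⇒≡0 0∣2^K) (>⇒≢ (m^n>0 2 K))
∣2^⇒2^ K (suc d) d∣2^K = only-2⇒2^ (suc d) (s≤s z≤n) (λ pr p∣d → prime∣2^⇒≡2 K pr (∣-trans p∣d d∣2^K))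

2^-injective : ∀ {a b} → 2 ^ a ≡ 2 ^ b → a ≡ b
2^-injective {a} {b} eq with <-cmp a b
... | tri≈ _ a≡b _ = a≡b
... | tri< a<b _ _ = contradiction eq (<⇒≢ (^-monoʳ-< 2 (s≤s (s≤s z≤n)) a<b))
... | tri> _ _ b<a = contradiction (sym eq) (<⇒≢ (^-monoʳ-< 2 (s≤s (s≤s z≤n)) b<a))

2^*x≡2^ : ∀ a x b → 2 ^ a * x ≡ 2 ^ b → a ≤ b × x ≡ 2 ^ (b ∸ a)
2^*x≡2^ a x b eq with ∣2^⇒2^ b x (divides (2 ^ a) (sym eq))
... | c , refl = subst (a ≤_) a+c≡b (m≤m+n a c) , cong (2 ^_) (sym (trans (cong (_∸ a) (sym a+c≡b)) (m+n∸m≡n a c)))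
  where
  a+c≡b : a + c ≡ b
  a+c≡b = 2^-injective (trans (^-distribˡ-+-* 2 a c) eq)

-- Fermat primes

parity : ∀ n → ∃ λ h → n ≡ 2 * h ⊎ n ≡ suc (2 * h)
parity zero = 0 , inj₁ refl
parity (suc n) with parity n
... | h , inj₁ n≡2h   = h , inj₂ (cong suc n≡2h)
... | h , inj₂ n≡2h+1 = suc h , inj₁ (trans (cong suc n≡2h+1) (sym (*-suc 2 h)))

x+1∣x^odd+1 : ∀ x c → x + 1 ∣ x ^ suc (2 * c) + 1
x+1∣x^odd+1 x       zero    rewrite *-identityʳ x = ∣-refl
x+1∣x^odd+1 zero    (suc c) = divides 1 refl
x+1∣x^odd+1 (suc y) (suc c) = subst (λ t → x + 1 ∣ t + 1) (sym x^2c+3) x+1∣x²z+1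
  where
  x = suc y
  z = x ^ suc (2 * c)
  x^2c+3 : x ^ suc (2 * suc c) ≡ x * x * z
  x^2c+3 = trans (cong (λ t → x ^ suc t) (*-suc 2 c)) (sym (*-assoc x x z))
  identity : ∀ y z → y * (suc y + 1) + (suc y * suc y * z + 1) ≡ suc y * suc y * (z + 1)
  identity = solve-∀
  x+1∣x²z+1 : x + 1 ∣ x * x * z + 1
  x+1∣x²z+1 = ∣m+n∣m⇒∣n (subst (x + 1 ∣_) (sym (identity y z)) (∣n⇒∣m*n (x * x) (x+1∣x^odd+1 x c)))
                        (∣n⇒∣m*n y ∣-refl)

-- If 2^i + 1 is prime with i > 0 then i is a power of two: an odd prime q = 2c + 1
-- dividing i = r · q would give the proper factor 2^r + 1 of (2^r)^q + 1.
prime-2^+1 : ∀ i → 0 < i → Prime (2 ^ i + 1) → ∃ λ a → i ≡ 2 ^ a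
prime-2^+1 i 0<i pr = only-2⇒2^ i 0<i only-2
  where
  only-2 : ∀ {q} → Prime q → q ∣ i → q ≡ 2
  only-2 {q} q-pr q∣i with parity q
  ... | h , inj₁ q≡2h with prime⇒irreducible q-pr (divides h (trans q≡2h (*-comm 2 h)))
  ...   | inj₁ 2≡1 = contradiction 2≡1 λ ()
  ...   | inj₂ 2≡q = sym 2≡q
  only-2 {q} q-pr (divides r i≡r*q) | c , inj₂ q≡2c+1 with prime⇒irreducible pr 2^r+1∣
    where
    2^r+1∣ : 2 ^ r + 1 ∣ 2 ^ i + 1
    2^r+1∣ = subst (λ t → 2 ^ r + 1 ∣ t + 1) 2^rq≡2^i (x+1∣x^odd+1 (2 ^ r) c)
      where
      2^rq≡2^i : (2 ^ r) ^ suc (2 * c) ≡ 2 ^ i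
      2^rq≡2^i = begin
        (2 ^ r) ^ suc (2 * c) ≡⟨ ^-*-assoc 2 r (suc (2 * c)) ⟩
        2 ^ (r * suc (2 * c)) ≡⟨ cong (λ t → 2 ^ (r * t)) (sym q≡2c+1) ⟩
        2 ^ (r * q)           ≡⟨ cong (2 ^_) (sym i≡r*q) ⟩
        2 ^ i                 ∎
        where open ≡-Reasoning
  ... | inj₁ 2^r+1≡1 = contradiction (+-cancelʳ-≡ 1 _ 0 2^r+1≡1) (>⇒≢ (m^n>0 2 r))
  ... | inj₂ 2^r+1≡2^i+1 = contradiction (sym 1≡q) (prime≢1 q-pr)
    where
    r≡i : r ≡ i
    r≡i = 2^-injective (+-cancelʳ-≡ 1 _ _ 2^r+1≡2^i+1)
    1≡q : 1 ≡ q
    1≡q = *-cancelˡ-≡ 1 q i {{>-nonZero 0<i}} (begin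
      i * 1 ≡⟨ *-identityʳ i ⟩
      i     ≡⟨ i≡r*q ⟩
      r * q ≡⟨ cong (_* q) r≡i ⟩
      i * q ∎)
      where open ≡-Reasoning

fermat-prime-form : ∀ {p} i → Prime p → p ≢ 2 → p ≡ 2 ^ i + 1 → ∃ λ j → p ≡ fermat j × i ≡ 2 ^ j
fermat-prime-form zero    pr p≢2 p≡2 = contradiction p≡2 p≢2
fermat-prime-form (suc i) pr p≢2 refl with prime-2^+1 (suc i) (s≤s z≤n) pr
... | j , i≡2^j = j , cong (λ t → 2 ^ t + 1) i≡2^j , i≡2^j

fermat-<-mono : ∀ {j k} → j < k → fermat j < fermat k
fermat-<-mono j<k = +-monoˡ-< 1 (^-monoʳ-< 2 (s≤s (s≤s z≤n)) (^-monoʳ-< 2 (s≤s (s≤s z≤n)) j<k))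

fermat-≤-mono : ∀ {j k} → j ≤ k → fermat j ≤ fermat k
fermat-≤-mono j≤k = +-monoˡ-≤ 1 (^-monoʳ-≤ 2 (^-monoʳ-≤ 2 j≤k))

fermat≢0 : ∀ k → NonZero (fermat k)
fermat≢0 k = >-nonZero (m≤n+m 1 (2 ^ 2 ^ k))

fermat≢2 : ∀ j → fermat j ≢ 2
fermat≢2 j F≡2 = >⇒≢ (^-monoʳ-< 2 (s≤s (s≤s z≤n)) (m^n>0 2 j)) (+-cancelʳ-≡ 1 _ _ F≡2)

-- Odd prime factors of solutions of φ m = 2^K

-- An odd prime divides a solution at most once: otherwise it would divide φ.
odd-prime-squarefree : ∀ K {p m′} → Prime p → p ≢ 2 → φ (p * m′) ≡ 2 ^ K → ¬ p ∣ m′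
odd-prime-squarefree K {p} {m′} pr p≢2 φ≡2^K p∣m′ = p≢2 (prime∣2^⇒≡2 K pr p∣2^K)
  where
  p∣2^K : p ∣ 2 ^ K
  p∣2^K = divides (φ m′) (trans (sym φ≡2^K) (trans (φ-*-divisor p m′ p∣m′) (*-comm p (φ m′))))

-- An odd prime factor p of a solution is a Fermat prime F_j with 2^j ≤ K: writing
-- m = p · m′ with p ∤ m′ gives (p − 1) · φ(m′) = 2^K, so p − 1 is a power of two.
odd-prime-factor : ∀ K {p m} → Prime p → p ∣ m → p ≢ 2 → φ m ≡ 2 ^ K → ∃ λ j → p ≡ fermat j × 2 ^ j ≤ K
odd-prime-factor K {zero} ()
odd-prime-factor K {suc p′} {m} pr p∣m p≢2 φm≡2^K =
  uncurry fermat-index (∣2^⇒2^ K p′ (divides (φ m′) (trans (sym p′*φm′≡2^K) (*-comm p′ (φ m′)))))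
  where
  m′ = quotient p∣m
  φpm′≡2^K : φ (suc p′ * m′) ≡ 2 ^ K
  φpm′≡2^K = trans (cong φ (sym (m∣n⇒n≡m*quotient p∣m))) φm≡2^K
  p′*φm′≡2^K : p′ * φ m′ ≡ 2 ^ K
  p′*φm′≡2^K = trans (sym (φ-*-prime (suc p′) m′ pr (odd-prime-squarefree K pr p≢2 φpm′≡2^K))) φpm′≡2^K
  fermat-index : ∀ i → p′ ≡ 2 ^ i → ∃ λ j → suc p′ ≡ fermat j × 2 ^ j ≤ K
  fermat-index i p′≡2^i with fermat-prime-form i pr p≢2 (trans (cong suc p′≡2^i) (+-comm 1 (2 ^ i)))
  ... | j , p≡F_j , i≡2^j = j , p≡F_j , subst (_≤ K) i≡2^j i≤K
    where
    i≤K : i ≤ K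
    i≤K = proj₁ (2^*x≡2^ i (φ m′) K (subst (λ t → t * φ m′ ≡ 2 ^ K) p′≡2^i p′*φm′≡2^K))

-- Products of distinct Fermat primes

-- FermatProduct k o s: o = F_{j₁} ⋯ F_{jᵣ} for distinct indices j₁, …, jᵣ < k with
-- every F_{jᵢ} prime, and s = 2^{j₁} + ⋯ + 2^{jᵣ} is its weight.
data FermatProduct : ℕ → ℕ → ℕ → Set where
  none : FermatProduct 0 1 0
  skip : ∀ {k o s} → FermatProduct k o s → FermatProduct (suc k) o s
  take : ∀ {k o s} → Prime (fermat k) → FermatProduct k o s →
         FermatProduct (suc k) (o * fermat k) (s + 2 ^ k)

FermatProduct-primeFactor : ∀ {k o s q} → FermatProduct k o s → Prime q → q ∣ o →
  ∃ λ j → j < k × q ≡ fermat j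
FermatProduct-primeFactor none     q-pr q∣1 = contradiction (∣1⇒≡1 q∣1) (prime≢1 q-pr)
FermatProduct-primeFactor (skip P) q-pr q∣o with FermatProduct-primeFactor P q-pr q∣o
... | j , j<k , q≡F_j = j , m<n⇒m<1+n j<k , q≡F_j
FermatProduct-primeFactor {suc k} (take {o = o} F-pr P) q-pr q∣oF with euclidsLemma o (fermat k) q-pr q∣oF
... | inj₁ q∣o with FermatProduct-primeFactor P q-pr q∣o
...   | j , j<k , q≡F_j = j , m<n⇒m<1+n j<k , q≡F_j
FermatProduct-primeFactor {suc k} (take F-pr P) q-pr q∣oF | inj₂ q∣F with prime⇒irreducible F-pr q∣F
...   | inj₁ q≡1 = contradiction q≡1 (prime≢1 q-pr)
...   | inj₂ q≡F = k , ≤-refl , q≡F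

fermat∤2^*FermatProduct : ∀ {k o s j} → FermatProduct k o s → k ≤ j → Prime (fermat j) →
  ∀ e → ¬ fermat j ∣ 2 ^ e * o
fermat∤2^*FermatProduct {j = j} P k≤j F-pr e F∣2^eo with euclidsLemma (2 ^ e) _ F-pr F∣2^eo
... | inj₁ F∣2^e = fermat≢2 j (prime∣2^⇒≡2 e F-pr F∣2^e)
... | inj₂ F∣o with FermatProduct-primeFactor P F-pr F∣o
...   | j′ , j′<k , F_j≡F_j′ = <⇒≢ (fermat-<-mono (<-≤-trans j′<k k≤j)) (sym F_j≡F_j′)

FermatProduct-positive : ∀ {k o s} → FermatProduct k o s → 0 < o
FermatProduct-positive none               = s≤s z≤n
FermatProduct-positive (skip P)           = FermatProduct-positive P
FermatProduct-positive (take {k = k} _ P) = *-mono-≤ (FermatProduct-positive P) (m≤n+m 1 (2 ^ 2 ^ k))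

-- The weight is a sum of distinct powers 2^j with j < k.
FermatProduct-weight : ∀ {k o s} → FermatProduct k o s → s < 2 ^ k
FermatProduct-weight none = s≤s z≤n
FermatProduct-weight {suc k} (skip P) = <-≤-trans (FermatProduct-weight P) (^-monoʳ-≤ 2 (n≤1+n k))
FermatProduct-weight {suc k} (take {s = s} _ P) =
  subst (s + 2 ^ k <_) (cong (2 ^ k +_) (sym (+-identityʳ _))) (+-monoˡ-< (2 ^ k) (FermatProduct-weight P))

-- Each F_j in o contributes a factor F_j − 1 = 2^(2^j) to φ(2^e · o).
φ-FermatProduct : ∀ {k o s} e → FermatProduct k o s → φ (2 ^ e * o) ≡ 2 ^ ((e ∸ 1) + s)
φ-FermatProduct e none = trans (cong φ (*-identityʳ (2 ^ e))) (trans (φ-2^ e) (cong (2 ^_) (sym (+-identityʳ (e ∸ 1)))))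
φ-FermatProduct e (skip P) = φ-FermatProduct e P
φ-FermatProduct {suc k} e (take {o = o} {s} F-pr P) = begin
  φ (2 ^ e * (o * F))                ≡⟨ cong φ (rearrange (2 ^ e) o F) ⟩
  φ (F * (2 ^ e * o))                ≡⟨ φ-*-prime F _ F-pr (fermat∤2^*FermatProduct P ≤-refl F-pr e) ⟩
  (F ∸ 1) * φ (2 ^ e * o)            ≡⟨ cong₂ _*_ (m+n∸n≡m (2 ^ 2 ^ k) 1) (φ-FermatProduct e P) ⟩
  2 ^ 2 ^ k * 2 ^ ((e ∸ 1) + s)      ≡⟨ sym (^-distribˡ-+-* 2 (2 ^ k) _) ⟩
  2 ^ (2 ^ k + ((e ∸ 1) + s))        ≡⟨ cong (2 ^_) (rotate (2 ^ k) (e ∸ 1) s) ⟩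
  2 ^ ((e ∸ 1) + (s + 2 ^ k))        ∎
  where
  open ≡-Reasoning
  F = fermat k
  rearrange : ∀ a b c → a * (b * c) ≡ c * (a * b)
  rearrange = solve-∀
  rotate : ∀ a b c → a + (b + c) ≡ b + (c + a)
  rotate = solve-∀

-- Structure of the solutions of φ m = 2^K

OddFactorsBelow : ℕ → ℕ → Set
OddFactorsBelow k m = ∀ {q} → Prime q → q ∣ m → q ≢ 2 → ∃ λ j → j < k × q ≡ fermat j

OddFactorsBelow-∣ : ∀ {k m m′} → m′ ∣ m → OddFactorsBelow k m → OddFactorsBelow k m′
OddFactorsBelow-∣ m′∣m odd q-pr q∣m′ = odd q-pr (∣-trans q∣m′ m′∣m)

OddFactorsBelow-pred : ∀ {k m} → OddFactorsBelow (suc k) m → ¬ (Prime (fermat k) × fermat k ∣ m) →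
  OddFactorsBelow k m
OddFactorsBelow-pred odd ¬F q-pr q∣m q≢2 with odd q-pr q∣m q≢2
... | j , j<1+k , q≡F_j with m<1+n⇒m<n∨m≡n j<1+k
...   | inj₁ j<k  = j , j<k , q≡F_j
...   | inj₂ refl = contradiction (subst Prime q≡F_j q-pr , subst (_∣ _) q≡F_j q∣m) ¬F

record Decomposition (k m K : ℕ) : Set where
  constructor decomposition
  field
    e o s   : ℕ
    fermatProduct : FermatProduct k o s
    m≡      : m ≡ 2 ^ e * o
    K≡      : K ≡ (e ∸ 1) + s

Decomposable : ℕ → Set
Decomposable k = ∀ {m K} → 0 < m → φ m ≡ 2 ^ K → OddFactorsBelow k m → Decomposition k m K

decompose-2^ : Decomposable 0
decompose-2^ {m} {K} 0<m φm≡2^K odd with only-2⇒2^ m 0<m only-2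
  where
  only-2 : ∀ {q} → Prime q → q ∣ m → q ≡ 2
  only-2 {q} q-pr q∣m with q ≟ 2
  ... | yes q≡2 = q≡2
  ... | no q≢2 with odd q-pr q∣m q≢2
  ...   | _ , () , _
... | e , refl = decomposition e 1 0 none (sym (*-identityʳ _)) K≡
  where
  K≡ : K ≡ (e ∸ 1) + 0
  K≡ = trans (sym (2^-injective (trans (sym (φ-2^ e)) φm≡2^K))) (sym (+-identityʳ _))

decompose-skip : ∀ {k} → Decomposable k → ∀ {m K} → 0 < m → φ m ≡ 2 ^ K → OddFactorsBelow (suc k) m →
  ¬ (Prime (fermat k) × fermat k ∣ m) → Decomposition (suc k) m K
decompose-skip rec 0<m φm≡2^K odd ¬F with rec 0<m φm≡2^K (OddFactorsBelow-pred odd ¬F)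
... | decomposition e o s P m≡ K≡ = decomposition e o s (skip P) m≡ K≡

-- Step for a prime F_k dividing m: m = F_k · m′ with F_k ∤ m′, φ(m′) = 2^(K − 2^k),
-- and F_k joins the Fermat product of the decomposition of m′.
decompose-take : ∀ {k} → Decomposable k → ∀ {m K} → 0 < m → φ m ≡ 2 ^ K → OddFactorsBelow (suc k) m →
  Prime (fermat k) → fermat k ∣ m → Decomposition (suc k) m K
decompose-take {k} rec {m} {K} 0<m φm≡2^K odd F-pr F∣m =
  extend (rec 0<m′ (proj₂ cancel) (OddFactorsBelow-pred (OddFactorsBelow-∣ m′∣m odd) (λ (_ , F∣m′) → F∤m′ F∣m′)))
  where
  F = fermat k
  m′ = quotient F∣m
  m≡Fm′ : m ≡ F * m′
  m≡Fm′ = m∣n⇒n≡m*quotient F∣m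
  m′∣m : m′ ∣ m
  m′∣m = divides F m≡Fm′
  0<m′ : 0 < m′
  0<m′ = n≢0⇒n>0 (λ m′≡0 → >⇒≢ 0<m (trans m≡Fm′ (trans (cong (F *_) m′≡0) (*-zeroʳ F))))
  φFm′≡2^K : φ (F * m′) ≡ 2 ^ K
  φFm′≡2^K = trans (cong φ (sym m≡Fm′)) φm≡2^K
  F∤m′ : ¬ F ∣ m′
  F∤m′ = odd-prime-squarefree K F-pr (fermat≢2 k) φFm′≡2^K
  cancel : 2 ^ k ≤ K × φ m′ ≡ 2 ^ (K ∸ 2 ^ k)
  cancel = 2^*x≡2^ (2 ^ k) (φ m′) K (trans (cong (_* φ m′) (sym (m+n∸n≡m (2 ^ 2 ^ k) 1)))
                                         (trans (sym (φ-*-prime F m′ F-pr F∤m′)) φFm′≡2^K))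
  rearrange : ∀ a b c → a * (b * c) ≡ b * (c * a)
  rearrange = solve-∀
  extend : Decomposition k m′ (K ∸ 2 ^ k) → Decomposition (suc k) m K
  extend (decomposition e o s P m′≡ K′≡) = decomposition e (o * F) (s + 2 ^ k) (take F-pr P)
    (trans m≡Fm′ (trans (cong (F *_) m′≡) (rearrange F (2 ^ e) o)))
    (trans (sym (m∸n+n≡m (proj₁ cancel))) (trans (cong (_+ 2 ^ k) K′≡) (+-assoc (e ∸ 1) s (2 ^ k))))

decompose : ∀ k → Decomposable k
decompose zero = decompose-2^
decompose (suc k) {m} 0<m φm≡2^K odd with prime? (fermat k) | fermat k ∣? m
... | yes F-pr | yes F∣m = decompose-take (decompose k) 0<m φm≡2^K odd F-pr F∣m
... | yes _    | no F∤m  = decompose-skip (decompose k) 0<m φm≡2^K odd (λ (_ , F∣m) → F∤m F∣m)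
... | no ¬F-pr | _       = decompose-skip (decompose k) 0<m φm≡2^K odd (λ (F-pr , _) → ¬F-pr F-pr)

-- Enumerating the Fermat products

adjoin : ℕ → ℕ × ℕ → ℕ × ℕ
adjoin k (o , s) = o * fermat k , s + 2 ^ k

using-F : (k : ℕ) → Dec (Prime (fermat k)) → List (ℕ × ℕ) → List (ℕ × ℕ)
using-F k (yes _) ps = map (adjoin k) ps
using-F k (no _)  _  = []

fermatProducts : ℕ → List (ℕ × ℕ)
fermatProducts zero    = (1 , 0) ∷ []
fermatProducts (suc k) = fermatProducts k ++ using-F k (prime? (fermat k)) (fermatProducts k)

FermatProduct⇒∈ : ∀ {k o s} → FermatProduct k o s → (o , s) ∈ fermatProducts k
FermatProduct⇒∈ none     = here refl
FermatProduct⇒∈ (skip P) = ∈-++⁺ˡ (FermatProduct⇒∈ P)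
FermatProduct⇒∈ {suc k} (take {o = o} {s} F-pr P) = ∈-++⁺ʳ (fermatProducts k) (new (prime? (fermat k)))
  where
  new : (d : Dec (Prime (fermat k))) → adjoin k (o , s) ∈ using-F k d (fermatProducts k)
  new (yes _)  = ∈-map⁺ (adjoin k) (FermatProduct⇒∈ P)
  new (no ¬F)  = contradiction F-pr ¬F

∈⇒FermatProduct : ∀ k {o s} → (o , s) ∈ fermatProducts k → FermatProduct k o s
∈⇒FermatProduct zero (here refl) = none
∈⇒FermatProduct (suc k) x∈ with ∈-++⁻ (fermatProducts k) x∈
... | inj₁ x∈old = skip (∈⇒FermatProduct k x∈old)
... | inj₂ x∈new = new (prime? (fermat k)) x∈new
  where
  new : ∀ {o s} (d : Dec (Prime (fermat k))) → (o , s) ∈ using-F k d (fermatProducts k) → FermatProduct (suc k) o s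
  new (yes F-pr) x∈ with ∈-map⁻ (adjoin k) x∈
  ... | _ , y∈ , refl = take F-pr (∈⇒FermatProduct k y∈)

adjoin-injective : ∀ k {x y} → adjoin k x ≡ adjoin k y → x ≡ y
adjoin-injective k {o , s} {o′ , s′} eq =
  cong₂ _,_ (*-cancelʳ-≡ o o′ (fermat k) {{fermat≢0 k}} (cong proj₁ eq)) (+-cancelʳ-≡ (2 ^ k) s s′ (cong proj₂ eq))

-- The list has no repetitions: the products using F_k have weight ≥ 2^k, the others < 2^k.
fermatProducts-unique : ∀ k → Unique (fermatProducts k)
fermatProducts-unique zero    = [] ∷ []
fermatProducts-unique (suc k) = Unique.++⁺ old! (new! (prime? (fermat k))) (disjoint (prime? (fermat k)))
  where
  old! = fermatProducts-unique k
  new! : (d : Dec (Prime (fermat k))) → Unique (using-F k d (fermatProducts k))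
  new! (yes _) = Unique.map⁺ (adjoin-injective k) old!
  new! (no _)  = []
  disjoint : (d : Dec (Prime (fermat k))) → Disjoint (fermatProducts k) (using-F k d (fermatProducts k))
  disjoint (yes _) (x∈old , x∈new) with ∈-map⁻ (adjoin k) x∈new
  ... | _ , _ , refl = <⇒≱ (FermatProduct-weight (∈⇒FermatProduct k x∈old)) (m≤n+m (2 ^ k) _)

primeFermatIndices : ℕ → ℕ
primeFermatIndices k = ∑[ j < k ] 𝟙 (prime? (fermat j))

-- Each prime F_k doubles the number of products.
fermatProducts-length : ∀ k → length (fermatProducts k) ≡ 2 ^ primeFermatIndices k
fermatProducts-length zero    = refl
fermatProducts-length (suc k) = trans (length-++ (fermatProducts k)) (step (prime? (fermat k)))
  where
  step : (d : Dec (Prime (fermat k))) →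
    length (fermatProducts k) + length (using-F k d (fermatProducts k)) ≡ 2 ^ (primeFermatIndices k + 𝟙 d)
  step (yes _) rewrite length-map (adjoin k) (fermatProducts k) | fermatProducts-length k
                     | ^-distribˡ-+-* 2 (primeFermatIndices k) 1 = x+x≡x*2 (2 ^ primeFermatIndices k)
    where
    x+x≡x*2 : ∀ x → x + x ≡ x * 2
    x+x≡x*2 = solve-∀
  step (no _) rewrite fermatProducts-length k | +-identityʳ (primeFermatIndices k) = +-identityʳ _

n<2^n : ∀ n → n < 2 ^ n
n<2^n zero    = s≤s z≤n
n<2^n (suc n) = <-≤-trans (s≤s (n<2^n n)) (subst (_≤ 2 * 2 ^ n) (+-comm (2 ^ n) 1) 2^n+1≤2*2^n)
  where
  2^n+1≤2*2^n : 2 ^ n + 1 ≤ 2 * 2 ^ n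
  2^n+1≤2*2^n = subst (2 ^ n + 1 ≤_) (cong (2 ^ n +_) (sym (+-identityʳ (2 ^ n)))) (+-monoʳ-≤ (2 ^ n) (m^n>0 2 n))

-- Counting prime Fermat numbers below F_n is counting prime F_j with j < n:
-- F_j < F_n iff j < n, and the indices j ≥ n below F_n contribute nothing.
primeFermatsBelow-fermat : ∀ n → primeFermatsBelow (fermat n) ≡ primeFermatIndices n
primeFermatsBelow-fermat n = begin
  primeFermatsBelow x                                   ≡⟨ length-filter D (λ j → j) x ⟩
  ∑ x (λ j → 𝟙 (D j))                                   ≡⟨ cong (λ t → ∑ t (λ j → 𝟙 (D j))) (sym (m+[n∸m]≡n n≤x)) ⟩
  ∑ (n + (x ∸ n)) (λ j → 𝟙 (D j))                       ≡⟨ ∑-split (λ j → 𝟙 (D j)) n (x ∸ n) ⟩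
  ∑ n (λ j → 𝟙 (D j)) + ∑[ i < x ∸ n ] 𝟙 (D (n + i))    ≡⟨ cong₂ _+_ (∑-cong n below) (∑-zero (x ∸ n) above) ⟩
  primeFermatIndices n + 0                              ≡⟨ +-identityʳ _ ⟩
  primeFermatIndices n                                  ∎
  where
  open ≡-Reasoning
  x = fermat n
  D = λ j → (fermat j <? x) ×-dec prime? (fermat j)
  n≤x : n ≤ x
  n≤x = ≤-trans (<⇒≤ (n<2^n n)) (≤-trans (<⇒≤ (n<2^n (2 ^ n))) (m≤m+n _ 1))
  below : ∀ j → j < n → 𝟙 (D j) ≡ 𝟙 (prime? (fermat j))
  below j j<n = 𝟙-cong proj₂ (λ F-pr → fermat-<-mono j<n , F-pr) (D j) (prime? (fermat j))
  above : ∀ i → i < x ∸ n → 𝟙 (D (n + i)) ≡ 0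
  above i _ = 𝟙-no (D (n + i)) (λ (F<x , _) → <⇒≱ F<x (fermat-≤-mono (m≤m+n n i)))

-- The solutions of φ m = 2^N

map-unique : ∀ {A B : Set} {f : A → B} {xs : List A} →
  (∀ {x y} → x ∈ xs → y ∈ xs → f x ≡ f y → x ≡ y) → Unique xs → Unique (map f xs)
map-unique inj []          = []
map-unique inj (x∉ ∷ xs!) =
  map⁺ (All.tabulate (λ y∈ fx≡fy → All.lookup x∉ y∈ (inj (here refl) (there y∈) fx≡fy)))
  ∷ map-unique (λ x∈ y∈ → inj (there x∈) (there y∈)) xs!

-- 2^e · o determines the Fermat product o and its weight: if F_k were chosen in only
-- one of two products, it would divide exactly one side.
FermatProduct-injective : ∀ {k o s o′ s′} → FermatProduct k o s → FermatProduct k o′ s′ →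
  ∀ e e′ → 2 ^ e * o ≡ 2 ^ e′ * o′ → o ≡ o′ × s ≡ s′
FermatProduct-injective none     none      e e′ eq = refl , refl
FermatProduct-injective (skip P) (skip P′) e e′ eq = FermatProduct-injective P P′ e e′ eq
FermatProduct-injective {suc k} (take {o = o} _ P) (take {o = o′} _ P′) e e′ eq
  with FermatProduct-injective P P′ e e′ (*-cancelʳ-≡ _ _ (fermat k) {{fermat≢0 k}} eq′)
  where
  eq′ : 2 ^ e * o * fermat k ≡ 2 ^ e′ * o′ * fermat k
  eq′ = trans (*-assoc (2 ^ e) o _) (trans eq (sym (*-assoc (2 ^ e′) o′ _)))
... | refl , refl = refl , refl
FermatProduct-injective (skip P) (take {o = o′} F-pr P′) e e′ eq =
  contradiction (divides (2 ^ e′ * o′) (trans eq (sym (*-assoc (2 ^ e′) o′ _)))) (fermat∤2^*FermatProduct P ≤-refl F-pr e)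
FermatProduct-injective (take {o = o} F-pr P) (skip P′) e e′ eq =
  contradiction (divides (2 ^ e * o) (trans (sym eq) (sym (*-assoc (2 ^ e) o _)))) (fermat∤2^*FermatProduct P′ ≤-refl F-pr e′)

-- The solution attached to a Fermat product (o, s) of weight s ≤ N: φ(2^(N − s + 1) · o) = 2^N.
solution : ℕ → ℕ × ℕ → ℕ
solution N (o , s) = 2 ^ suc (N ∸ s) * o

solutions : ℕ → ℕ → List ℕ
solutions k N = map (solution N) (fermatProducts k)

solutions-sound : ∀ k N → 2 ^ k ≤ N → ∀ {m} → m ∈ solutions k N → 0 < m × φ m ≡ 2 ^ N
solutions-sound k N 2^k≤N m∈ with ∈-map⁻ (solution N) m∈
... | (o , s) , p∈ , refl =
  *-mono-≤ (m^n>0 2 (suc (N ∸ s))) (FermatProduct-positive P) ,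
  trans (φ-FermatProduct (suc (N ∸ s)) P) (cong (2 ^_) (m∸n+n≡m s≤N))
  where
  P = ∈⇒FermatProduct k p∈
  s≤N : s ≤ N
  s≤N = <⇒≤ (<-≤-trans (FermatProduct-weight P) 2^k≤N)

solutions-unique : ∀ k N → Unique (solutions k N)
solutions-unique k N = map-unique injective (fermatProducts-unique k)
  where
  injective : ∀ {x y} → x ∈ fermatProducts k → y ∈ fermatProducts k → solution N x ≡ solution N y → x ≡ y
  injective {o , s} {o′ , s′} x∈ y∈ eq
    with FermatProduct-injective (∈⇒FermatProduct k x∈) (∈⇒FermatProduct k y∈) (suc (N ∸ s)) (suc (N ∸ s′)) eq
  ... | refl , refl = refl

FermatProduct-drop : ∀ {k o s} → ¬ Prime (fermat k) → FermatProduct (suc k) o s → FermatProduct k o s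
FermatProduct-drop ¬F-pr (skip P)      = P
FermatProduct-drop ¬F-pr (take F-pr P) = contradiction F-pr ¬F-pr

-- If 2^n ≤ N < 2^(n+1) and F_n is composite, every solution is in the list: its odd
-- prime factors are F_j with 2^j ≤ N, so j ≤ n, and in fact j < n; the weight is then
-- s < 2^n ≤ N, which forces the exponent of 2 to be N − s + 1.
solutions-complete : ∀ n N → ¬ Prime (fermat n) → 2 ^ n ≤ N → N < 2 ^ suc n →
  ∀ {m} → 0 < m → φ m ≡ 2 ^ N → m ∈ solutions n N
solutions-complete n N ¬F-pr 2^n≤N N<2^n+1 {m} 0<m φm≡2^N with decompose (suc n) 0<m φm≡2^N odd
  where
  odd : OddFactorsBelow (suc n) m
  odd q-pr q∣m q≢2 with odd-prime-factor N q-pr q∣m q≢2 φm≡2^N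
  ... | j , q≡F_j , 2^j≤N = j , ≰⇒> (λ n+1≤j → <⇒≱ N<2^n+1 (≤-trans (^-monoʳ-≤ 2 n+1≤j) 2^j≤N)) , q≡F_j
... | decomposition e o s P m≡ N≡ = exponent e m≡ N≡
  where
  P′ = FermatProduct-drop ¬F-pr P
  s<N : s < N
  s<N = <-≤-trans (FermatProduct-weight P′) 2^n≤N
  exponent : ∀ e → m ≡ 2 ^ e * o → N ≡ (e ∸ 1) + s → m ∈ solutions n N
  exponent zero    _  N≡s  = contradiction (sym N≡s) (<⇒≢ s<N)
  exponent (suc e) m≡ N≡e+s = subst (_∈ solutions n N) (sym m≡′) (∈-map⁺ (solution N) (FermatProduct⇒∈ P′))
    where
    m≡′ : m ≡ 2 ^ suc (N ∸ s) * o
    m≡′ = trans m≡ (cong (λ t → 2 ^ suc t * o) (sym (trans (cong (_∸ s) N≡e+s) (m+n∸n≡m e s))))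

theorem2 : (n : ℕ) → ¬ Prime (fermat n) → (a : ℕ) → 0 < a → a < 2 ^ n →
    Σ (List ℕ) λ ms →
    Unique ms
    × (∀ m → (m ∈ ms) ⇔ ((0 < m) × (φ m ≡ 2 ^ (2 ^ n + a))))
    × (length ms ≡ 2 ^ primeFermatsBelow (fermat n))
theorem2 n ¬F-pr a _ a<2^n =
  solutions n N ,
  solutions-unique n N ,
  (λ m → mk⇔ (solutions-sound n N 2^n≤N) (λ (0<m , φm≡2^N) → solutions-complete n N ¬F-pr 2^n≤N N<2^n+1 0<m φm≡2^N)) ,
  count
  where
  N = 2 ^ n + a
  2^n≤N : 2 ^ n ≤ N
  2^n≤N = m≤m+n (2 ^ n) a
  N<2^n+1 : N < 2 ^ suc n
  N<2^n+1 = subst (N <_) (cong (2 ^ n +_) (sym (+-identityʳ (2 ^ n)))) (+-monoʳ-< (2 ^ n) a<2^n)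
  count : length (solutions n N) ≡ 2 ^ primeFermatsBelow (fermat n)
  count = begin
    length (solutions n N)           ≡⟨ length-map (solution N) (fermatProducts n) ⟩
    length (fermatProducts n)        ≡⟨ fermatProducts-length n ⟩
    2 ^ primeFermatIndices n         ≡⟨ cong (2 ^_) (sym (primeFermatsBelow-fermat n)) ⟩
    2 ^ primeFermatsBelow (fermat n) ∎
    where open ≡-Reasoning
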